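{- In $GP(2k+1,2)$, for even $r$ with $5<r\le k$, there is a unique geodesic joining $u_0$ and $u_r$; it passes through the spokes $u_0v_0$ and $u_rv_r$ and through the inner vertices lying between $v_0$ and $v_r$ (namely $v_0,v_2,\dots,v_r$).
   Context: For an integer $n\ge 5$, $GP(n,2)$ is the graph with vertex set $\{u_0,\dots,u_{n-1},v_0,\dots,v_{n-1}\}$ and edges $u_iu_{i+1}$ (outer edges), $u_iv_i$ (spokes) and $v_iv_{i+2}$ (inner edges) for $0\le i\le n-1$, subscripts modulo $n$. The $u_i$ are outer vertices, the $v_i$ inner vertices. A geodesic is a shortest path. -}

module Defs where

open import Data.Nat using (ℕ; zero; suc; _+_; _*_; _/_; NonZero)
open import Data.Nat.DivMod using (_mod_)
open import Data.Fin using (Fin; toℕ)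
open import Data.List using (List; []; _∷_; map; upTo; _++_; [_])
open import Relation.Binary.PropositionalEquality using (_≡_)

data Vertex (n : ℕ) : Set where
  u : Fin n → Vertex n
  v : Fin n → Vertex n

U : (n : ℕ) .{{_ : NonZero n}} → ℕ → Vertex n
U n i = u (i mod n)

V : (n : ℕ) .{{_ : NonZero n}} → ℕ → Vertex n
V n i = v (i mod n)

data Adj (n : ℕ) .{{_ : NonZero n}} : Vertex n → Vertex n → Set where
  outer⁺ : ∀ i → Adj n (u i) (U n (toℕ i + 1))
  outer⁻ : ∀ i → Adj n (U n (toℕ i + 1)) (u i)
  spoke⁺ : ∀ i → Adj n (u i) (v i)
  spoke⁻ : ∀ i → Adj n (v i) (u i)
  inner⁺ : ∀ i → Adj n (v i) (V n (toℕ i + 2))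
  inner⁻ : ∀ i → Adj n (V n (toℕ i + 2)) (v i)

data Walk (n : ℕ) .{{_ : NonZero n}} : Vertex n → Vertex n → Set where
  [] : ∀ {x} → Walk n x x
  _∷_ : ∀ {x y z} → Adj n x y → Walk n y z → Walk n x z

len : ∀ {n} .{{_ : NonZero n}} {x y} → Walk n x y → ℕ
len [] = 0
len (_ ∷ w) = suc (len w)

vertices : ∀ {n} .{{_ : NonZero n}} {x y} → Walk n x y → List (Vertex n)
vertices {x = x} [] = x ∷ []
vertices {x = x} (_ ∷ w) = x ∷ vertices w

IsGeodesic : ∀ {n} .{{_ : NonZero n}} {x y} → Walk n x y → Set
IsGeodesic {n} {x = x} {y} w = ∀ (w' : Walk n x y) → len w Data.Nat.≤ len w'
  where import Data.Nat

-- The vertex sequence u_0, v_0, v_2, ..., v_r, u_r (r even).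
spokeInnerPath : (n : ℕ) .{{_ : NonZero n}} → ℕ → List (Vertex n)
spokeInnerPath n r = U n 0 ∷ (map (λ j → V n (2 * j)) (upTo (r / 2 + 1)) ++ [ U n r ])

-- Write r = 2m and L = m + 2, the length of the path u₀ v₀ v₂ … v_r u_r. If c is the
-- distance of an index from 0 around the cycle ℤ_n, the numbers min(c, ⌈c/2⌉ + 2) at u_c and
-- ⌈c/2⌉ + 1 at v_c change by at most one along every edge, so they bound from below the
-- distance to u₀; shifting indices by r gives the same bound P_r for the distance to u_r.
-- At every vertex P₀ + P_r ≥ L, with equality exactly on that path, whose j-th vertex is
-- the one with P₀ = j (here r > 5 is needed: for r = 4 the outer path u₀ u₁ … u₄ also has
-- length L). Along a walk of length L from u₀ to u_r, P₀ must therefore rise by one at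
-- every step while P₀ + P_r stays equal to L, which pins down every vertex of the walk.
module Submission where

open import Defs
open import Data.Nat using (ℕ; suc; _*_; _<_; _≤_)
open import Data.Nat.Divisibility using (_∣_)
open import Data.Product using (Σ; _×_)
open import Relation.Binary.PropositionalEquality using (_≡_)

open import Data.Empty using (⊥-elim)
open import Data.Fin using (Fin; toℕ)
open import Data.Fin.Properties using (toℕ<n; toℕ-fromℕ<; toℕ-injective)
open import Data.List using (List; []; _∷_; [_]; _++_; _∷ʳ_; map; upTo)
open import Data.List.Properties using (map-++; upTo-∷ʳ)
open import Data.Nat using (zero; _+_; _∸_; _⊓_; _/_; ⌈_/2⌉; z≤n; s≤s; s≤s⁻¹; _≤?_; NonZero)
open import Data.Nat.DivMod using (_%_; _mod_; %-distribˡ-+; m%n%n≡m%n; m%n<n; m<n⇒m%n≡m; n%n≡0; [m+n]%n≡m%n; m*n/n≡m)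
open import Data.Nat.Divisibility using (divides)
open import Data.Nat.Properties
open import Data.Product using (_,_; proj₁; proj₂)
open import Data.Sum using (_⊎_; inj₁; inj₂)
open import Relation.Binary.PropositionalEquality using (refl; sym; trans; cong; cong₂; subst; module ≡-Reasoning)
open import Relation.Nullary using (yes; no)
open import Algebra.Properties.CommutativeSemigroup +-commutativeSemigroup
  using (interchange; x∙yz≈y∙xz; x∙yz≈z∙yx; x∙yz≈z∙xy; x∙yz≈yx∙z)

⌈1+n/2⌉≤1+⌈n/2⌉ : ∀ n → ⌈ suc n /2⌉ ≤ suc ⌈ n /2⌉
⌈1+n/2⌉≤1+⌈n/2⌉ n = s≤s (⌊n/2⌋≤⌈n/2⌉ n)

⌈m+n/2⌉≤⌈m/2⌉+⌈n/2⌉ : ∀ m n → ⌈ m + n /2⌉ ≤ ⌈ m /2⌉ + ⌈ n /2⌉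
⌈m+n/2⌉≤⌈m/2⌉+⌈n/2⌉ zero          n = ≤-refl
⌈m+n/2⌉≤⌈m/2⌉+⌈n/2⌉ (suc zero)    n = ⌈1+n/2⌉≤1+⌈n/2⌉ n
⌈m+n/2⌉≤⌈m/2⌉+⌈n/2⌉ (suc (suc m)) n = s≤s (⌈m+n/2⌉≤⌈m/2⌉+⌈n/2⌉ m n)

n≤⌈n/2⌉+⌈n/2⌉ : ∀ n → n ≤ ⌈ n /2⌉ + ⌈ n /2⌉
n≤⌈n/2⌉+⌈n/2⌉ n = subst (_≤ ⌈ n /2⌉ + ⌈ n /2⌉) (⌊n/2⌋+⌈n/2⌉≡n n) (+-monoˡ-≤ ⌈ n /2⌉ (⌊n/2⌋≤⌈n/2⌉ n))

m+m≤n⇒m≤⌈n/2⌉ : ∀ {m n} → m + m ≤ n → m ≤ ⌈ n /2⌉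
m+m≤n⇒m≤⌈n/2⌉ {m} le = subst (_≤ _) (sym (n≡⌈n+n/2⌉ m)) (⌈n/2⌉-mono le)

m+m<n⇒m<⌈n/2⌉ : ∀ {m n} → m + m < n → m < ⌈ n /2⌉
m+m<n⇒m<⌈n/2⌉ {m} lt = subst (λ x → suc x ≤ _) (sym (n≡⌊n+n/2⌋ m)) (⌈n/2⌉-mono lt)

⊓+⊓-glb : ∀ {o} a b c d → o ≤ a + c → o ≤ a + d → o ≤ b + c → o ≤ b + d → o ≤ a ⊓ b + c ⊓ d
⊓+⊓-glb a b c d ac ad bc bd = subst (_ ≤_) (sym expand) (⊓-glb (⊓-glb ac ad) (⊓-glb bc bd))
  where
  expand : a ⊓ b + c ⊓ d ≡ (a + c) ⊓ (a + d) ⊓ ((b + c) ⊓ (b + d))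
  expand = trans (+-distribʳ-⊓ (c ⊓ d) a b) (cong₂ _⊓_ (+-distribˡ-⊓ a c d) (+-distribˡ-⊓ b c d))

⊓-arcs : ∀ {r e f} → 1 ≤ e → 1 ≤ f → suc r ≤ e + f →
         1 ≤ (r + e) ⊓ f × 1 ≤ e ⊓ (r + f) × suc r ≤ (r + e) ⊓ f + e ⊓ (r + f)
⊓-arcs {r} {e} {f} 1≤e 1≤f 1+r≤e+f =
    ⊓-glb (≤-trans 1≤e (m≤n+m e r)) 1≤f
  , ⊓-glb 1≤e (≤-trans 1≤f (m≤n+m f r))
  , ⊓+⊓-glb (r + e) f e (r + f)
      (≤-trans (m<m+n r 1≤e) (m≤m+n (r + e) e))
      (≤-trans (m<m+n r 1≤e) (m≤m+n (r + e) (r + f)))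
      (subst (suc r ≤_) (+-comm e f) 1+r≤e+f)
      (≤-trans (m<m+n r 1≤f) (m≤n+m (r + f) f))

-- For c small compared to n, the distances from u₀ to u_c and to v_c: go along the outer
-- cycle, or along u₀ v₀ v₂ v₄ … with one extra outer edge when c is odd.
outerPot : ℕ → ℕ
outerPot c = c ⊓ (2 + ⌈ c /2⌉)

innerPot : ℕ → ℕ
innerPot c = 1 + ⌈ c /2⌉

outerPot-step : ∀ {c c′} → c′ ≤ suc c → outerPot c′ ≤ suc (outerPot c)
outerPot-step {c} c′≤1+c =
  ⊓-mono-≤ c′≤1+c (s≤s (s≤s (≤-trans (⌈n/2⌉-mono c′≤1+c) (⌈1+n/2⌉≤1+⌈n/2⌉ c))))

innerPot-step : ∀ {c c′} → c′ ≤ 2 + c → innerPot c′ ≤ suc (innerPot c)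
innerPot-step c′≤2+c = s≤s (⌈n/2⌉-mono c′≤2+c)

outerPot≤1+innerPot : ∀ c → outerPot c ≤ suc (innerPot c)
outerPot≤1+innerPot c = m⊓n≤n c _

innerPot≤1+outerPot : ∀ c → innerPot c ≤ suc (outerPot c)
innerPot≤1+outerPot c = s≤s (⊓-glb (⌈n/2⌉≤n c) (m≤n+m _ 2))

outerPot-double : ∀ {m} → 2 ≤ m → outerPot (m + m) ≡ 2 + m
outerPot-double {m} 2≤m = begin
  (m + m) ⊓ (2 + ⌈ m + m /2⌉) ≡⟨ cong (λ x → (m + m) ⊓ (2 + x)) (n≡⌈n+n/2⌉ m) ⟨
  (m + m) ⊓ (2 + m)           ≡⟨ m≥n⇒m⊓n≡n (+-monoˡ-≤ m 2≤m) ⟩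
  2 + m                       ∎
  where open ≡-Reasoning

innerPot-sum : ∀ c d → innerPot c + innerPot d ≡ 2 + (⌈ c /2⌉ + ⌈ d /2⌉)
innerPot-sum c d = cong suc (+-suc ⌈ c /2⌉ ⌈ d /2⌉)

innerPot-sum-≥ : ∀ {m c d} → m + m ≤ c + d → 2 + m ≤ innerPot c + innerPot d
innerPot-sum-≥ {m} {c} {d} m+m≤c+d = subst (2 + m ≤_) (sym (innerPot-sum c d))
  (s≤s (s≤s (≤-trans (m+m≤n⇒m≤⌈n/2⌉ m+m≤c+d) (⌈m+n/2⌉≤⌈m/2⌉+⌈n/2⌉ c d))))

outerPot-sum : ∀ {m c d} → 3 ≤ m → 1 ≤ c → 1 ≤ d → m + m ≤ c + d → 3 + m ≤ outerPot c + outerPot d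
outerPot-sum {m} {c} {d} 3≤m 1≤c 1≤d m+m≤c+d =
  ⊓+⊓-glb c _ d _ outer-outer (outer-inner 1≤c m+m≤c+d)
    (subst (3 + m ≤_) (+-comm d _) (outer-inner 1≤d (subst (m + m ≤_) (+-comm c d) m+m≤c+d)))
    inner-inner
  where
  outer-outer : 3 + m ≤ c + d
  outer-outer = ≤-trans (+-monoˡ-≤ m 3≤m) m+m≤c+d
  outer-inner : ∀ {a b} → 1 ≤ a → m + m ≤ a + b → 3 + m ≤ a + (2 + ⌈ b /2⌉)
  outer-inner {a} {b} 1≤a m+m≤a+b = subst (3 + m ≤_) (sym (x∙yz≈y∙xz a 2 ⌈ b /2⌉)) (s≤s (s≤s m<a+⌈b/2⌉))
    where
    m<a+⌈b/2⌉ : m < a + ⌈ b /2⌉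
    m<a+⌈b/2⌉ = begin-strict
      m                        <⟨ m+m<n⇒m<⌈n/2⌉ (≤-<-trans m+m≤a+b (+-monoˡ-< b (m<m+n a 1≤a))) ⟩
      ⌈ a + a + b /2⌉          ≤⟨ ⌈m+n/2⌉≤⌈m/2⌉+⌈n/2⌉ (a + a) b ⟩
      ⌈ a + a /2⌉ + ⌈ b /2⌉    ≡⟨ cong (_+ ⌈ b /2⌉) (n≡⌈n+n/2⌉ a) ⟨
      a + ⌈ b /2⌉              ∎
      where open ≤-Reasoning
  inner-inner : 3 + m ≤ (2 + ⌈ c /2⌉) + (2 + ⌈ d /2⌉)
  inner-inner = s≤s (≤-trans (innerPot-sum-≥ m+m≤c+d) (+-monoʳ-≤ (innerPot c) (n≤1+n _)))

innerPot-sum-> : ∀ {m c d} → m + m < c + d → 3 + m ≤ innerPot c + innerPot d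
innerPot-sum-> {m} {c} {d} m+m<c+d = subst (3 + m ≤_) (sym (innerPot-sum c d))
  (s≤s (s≤s (≤-trans (m+m<n⇒m<⌈n/2⌉ m+m<c+d) (⌈m+n/2⌉≤⌈m/2⌉+⌈n/2⌉ c d))))

innerPot-sum-tight : ∀ {m c d} → c + d ≡ m + m → innerPot c + innerPot d ≤ 2 + m →
                     c ≡ ⌈ c /2⌉ + ⌈ c /2⌉
innerPot-sum-tight {m} {c} {d} c+d≡m+m tight =
  ≤-antisym (n≤⌈n/2⌉+⌈n/2⌉ c) (+-cancelʳ-≤ d _ _ C+C+d≤c+d)
  where
  C = ⌈ c /2⌉
  D = ⌈ d /2⌉
  C+D≤m : C + D ≤ m
  C+D≤m = s≤s⁻¹ (s≤s⁻¹ (subst (_≤ 2 + m) (innerPot-sum c d) tight))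
  C+C+d≤c+d : C + C + d ≤ c + d
  C+C+d≤c+d = begin
    C + C + d        ≤⟨ +-monoʳ-≤ (C + C) (n≤⌈n/2⌉+⌈n/2⌉ d) ⟩
    C + C + (D + D)  ≡⟨ interchange C C D D ⟩
    C + D + (C + D)  ≤⟨ +-mono-≤ C+D≤m C+D≤m ⟩
    m + m            ≡⟨ c+d≡m+m ⟨
    c + d            ∎
    where open ≤-Reasoning

trace : ∀ {A : Set} → (ℕ → A) → ℕ → ℕ → List A
trace p j zero    = [ p j ]
trace p j (suc n) = p j ∷ trace p (suc j) n

trace-∷ʳ : ∀ {A : Set} (p : ℕ → A) j n → trace p j (suc n) ≡ trace p j n ∷ʳ p (j + suc n)
trace-∷ʳ p j zero    = cong (λ i → p j ∷ [ p i ]) (+-comm 1 j)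
trace-∷ʳ p j (suc n) = cong (p j ∷_)
  (trans (trace-∷ʳ p (suc j) n) (cong (λ i → trace p (suc j) n ∷ʳ p i) (sym (+-suc j (suc n)))))

module GeneralizedPetersen (n : ℕ) .{{_ : NonZero n}} where

  Adj-sym : ∀ {x y} → Adj n x y → Adj n y x
  Adj-sym (outer⁺ i) = outer⁻ i
  Adj-sym (outer⁻ i) = outer⁺ i
  Adj-sym (spoke⁺ i) = spoke⁻ i
  Adj-sym (spoke⁻ i) = spoke⁺ i
  Adj-sym (inner⁺ i) = inner⁻ i
  Adj-sym (inner⁻ i) = inner⁺ i

  Lipschitz : (Vertex n → ℕ) → Set
  Lipschitz f = ∀ {x y} → Adj n x y → f y ≤ suc (f x)

  lipschitz-walk : ∀ {f} → Lipschitz f → ∀ {x y} (w : Walk n x y) → f y ≤ f x + len w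
  lipschitz-walk f-lip         []      = ≤-reflexive (sym (+-identityʳ _))
  lipschitz-walk {f} f-lip {x} (e ∷ w) = begin
    _                 ≤⟨ lipschitz-walk f-lip w ⟩
    _ + len w         ≤⟨ +-monoˡ-≤ (len w) (f-lip e) ⟩
    suc (f x) + len w ≡⟨ +-suc (f x) (len w) ⟨
    f x + suc (len w) ∎
    where open ≤-Reasoning

  lipschitz-walk⁻ : ∀ {f} → Lipschitz f → ∀ {x y} (w : Walk n x y) → f x ≤ f y + len w
  lipschitz-walk⁻ f-lip         []      = ≤-reflexive (sym (+-identityʳ _))
  lipschitz-walk⁻ {f} f-lip {y = y} (e ∷ w) = begin
    _                 ≤⟨ f-lip (Adj-sym e) ⟩
    suc _             ≤⟨ s≤s (lipschitz-walk⁻ f-lip w) ⟩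
    suc (f y + len w) ≡⟨ +-suc (f y) (len w) ⟨
    f y + suc (len w) ∎
    where open ≤-Reasoning

  -- Along a walk w from x to t with f x + len w = L, the sum f + g stays equal to L and
  -- f rises by one at each step.
  module TightWalks {f g : Vertex n → ℕ} (f-lip : Lipschitz f) (g-lip : Lipschitz g) {L : ℕ}
                    (f+g≥L : ∀ x → L ≤ f x + g x) {p : ℕ → Vertex n}
                    (f+g≤L⇒on-p : ∀ x → f x + g x ≤ L → x ≡ p (f x))
                    {t : Vertex n} (g-t : g t ≡ 0) where

    g≤len : ∀ {x} (w : Walk n x t) → g x ≤ len w
    g≤len {x} w = subst (λ gt → g x ≤ gt + len w) g-t (lipschitz-walk⁻ g-lip w)

    on-p : ∀ {x} (w : Walk n x t) → f x + len w ≡ L → x ≡ p (f x)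
    on-p {x} w tight = f+g≤L⇒on-p x (subst (f x + g x ≤_) tight (+-monoʳ-≤ (f x) (g≤len w)))

    tight-walk : ∀ {x} (w : Walk n x t) → f x + len w ≡ L → vertices w ≡ trace p (f x) (len w)
    tight-walk [] tight = cong [_] (on-p [] tight)
    tight-walk {x} (_∷_ {y = y} e w) tight =
      cong₂ _∷_ (on-p (e ∷ w) tight)
        (subst (λ j → vertices w ≡ trace p j (len w)) fy≡1+fx
          (tight-walk w (trans (cong (_+ len w) fy≡1+fx) tight′)))
      where
      tight′ : suc (f x) + len w ≡ L
      tight′ = trans (sym (+-suc (f x) (len w))) tight
      fy≡1+fx : f y ≡ suc (f x)
      fy≡1+fx = ≤-antisym (f-lip e) (+-cancelʳ-≤ (len w) _ _ (begin
        suc (f x) + len w ≡⟨ tight′ ⟩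
        L                 ≤⟨ f+g≥L y ⟩
        f y + g y         ≤⟨ +-monoʳ-≤ (f y) (g≤len w) ⟩
        f y + len w       ∎))
        where open ≤-Reasoning

  [m+n%n]%n≡[m+n]%n : ∀ a b → (a + b % n) % n ≡ (a + b) % n
  [m+n%n]%n≡[m+n]%n a b = begin
    (a + b % n) % n         ≡⟨ %-distribˡ-+ a (b % n) n ⟩
    (a % n + b % n % n) % n ≡⟨ cong (λ y → (a % n + y) % n) (m%n%n≡m%n b n) ⟩
    (a % n + b % n) % n     ≡⟨ %-distribˡ-+ a b n ⟨
    (a + b) % n             ∎
    where open ≡-Reasoning

  mod-cong : ∀ {x y} → x % n ≡ y % n → x mod n ≡ y mod n
  mod-cong eq = toℕ-injective (trans (toℕ-fromℕ< _) (trans eq (sym (toℕ-fromℕ< _))))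

  toℕ≡⇒≡mod : ∀ {i : Fin n} {x} → toℕ i ≡ x → i ≡ x mod n
  toℕ≡⇒≡mod {i} refl = toℕ-injective (sym (trans (toℕ-fromℕ< _) (m<n⇒m%n≡m (toℕ<n i))))

  cdist′ : ℕ → ℕ
  cdist′ j = j ⊓ (n ∸ j)

  cdist : ℕ → ℕ
  cdist z = cdist′ (z % n)

  cdist-split : ∀ {x y} → x + y ≡ n → 0 < y → cdist x ≡ x ⊓ y
  cdist-split {x} {y} x+y≡n 0<y = begin
    cdist′ (x % n) ≡⟨ cong cdist′ (m<n⇒m%n≡m (subst (x <_) x+y≡n (m<m+n x 0<y))) ⟩
    x ⊓ (n ∸ x)    ≡⟨ cong (λ z → x ⊓ (z ∸ x)) x+y≡n ⟨
    x ⊓ (x + y ∸ x) ≡⟨ cong (x ⊓_) (m+n∸m≡n x y) ⟩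
    x ⊓ y          ∎
    where open ≡-Reasoning

  cdist-n : cdist n ≡ 0
  cdist-n = cong cdist′ (n%n≡0 n)

  cdist-+n : ∀ x → cdist (x + n) ≡ cdist x
  cdist-+n x = cong cdist′ ([m+n]%n≡m%n x n)

  cdist-small : ∀ {x} → x + x < n → cdist x ≡ x
  cdist-small {x} x+x<n = trans (cong cdist′ (m<n⇒m%n≡m (≤-<-trans (m≤m+n x x) x+x<n)))
                                (m≤n⇒m⊓n≡m (m+n≤o⇒m≤o∸n x (<⇒≤ x+x<n)))

  cdist-complement : ∀ {x e} → x + e ≡ n → e + e < n → cdist x ≡ e
  cdist-complement {x} {zero}  x+0≡n _ = trans (cong cdist (trans (sym (+-identityʳ x)) x+0≡n)) cdist-n
  cdist-complement {x} {suc e} x+e≡n e+e<n = trans (cdist-split x+e≡n (s≤s z≤n))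
    (m≥n⇒m⊓n≡n (<⇒≤ (+-cancelʳ-< (suc e) _ x (subst (suc e + suc e <_) (sym x+e≡n) e+e<n))))

  cdist′-% : ∀ {j} → j ≤ n → cdist′ (j % n) ≡ cdist′ j
  cdist′-% {j} j≤n with m≤n⇒m<n∨m≡n j≤n
  ... | inj₁ j<n = cong cdist′ (m<n⇒m%n≡m j<n)
  ... | inj₂ j≡n = begin
    cdist′ (j % n) ≡⟨ cong (λ x → cdist′ (x % n)) j≡n ⟩
    cdist′ (n % n) ≡⟨ cong cdist′ (n%n≡0 n) ⟩
    0              ≡⟨ ⊓-zeroʳ n ⟨
    n ⊓ 0          ≡⟨ cong (n ⊓_) (n∸n≡0 n) ⟨
    cdist′ n       ≡⟨ cong cdist′ j≡n ⟨
    cdist′ j       ∎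
    where open ≡-Reasoning

  cdist′-suc : ∀ {j} → suc j ≤ n → cdist′ (suc j) ≤ suc (cdist′ j) × cdist′ j ≤ suc (cdist′ (suc j))
  cdist′-suc {j} 1+j≤n rewrite +-∸-assoc 1 1+j≤n =
    ⊓-monoʳ-≤ (suc j) (m≤n⇒m≤1+n (n≤1+n _)) , ⊓-monoˡ-≤ (suc (n ∸ suc j)) (m≤n⇒m≤1+n (n≤1+n j))

  cdist-suc : ∀ z → cdist (suc z) ≤ suc (cdist z) × cdist z ≤ suc (cdist (suc z))
  cdist-suc z rewrite sym ([m+n%n]%n≡[m+n]%n 1 z) | cdist′-% (m%n<n z n) = cdist′-suc (m%n<n z n)

  cdist-+2 : ∀ z → cdist (2 + z) ≤ 2 + cdist z × cdist z ≤ 2 + cdist (2 + z)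
  cdist-+2 z = ≤-trans (proj₁ (cdist-suc (suc z))) (s≤s (proj₁ (cdist-suc z)))
             , ≤-trans (proj₂ (cdist-suc z)) (s≤s (proj₂ (cdist-suc (suc z))))

  cdist-+-mod : ∀ s x → cdist (s + toℕ (x mod n)) ≡ cdist (s + x)
  cdist-+-mod s x = cong cdist′ (trans (cong (λ y → (s + y) % n) (toℕ-fromℕ< _)) ([m+n%n]%n≡[m+n]%n s x))

  cdist-edge : ∀ s (i : Fin n) d → cdist (s + toℕ ((toℕ i + d) mod n)) ≡ cdist (d + (s + toℕ i))
  cdist-edge s i d = trans (cdist-+-mod s (toℕ i + d)) (cong cdist (x∙yz≈z∙xy s (toℕ i) d))

  -- Pot s x bounds from below the distance from u_{-s} to x.
  Pot : ℕ → Vertex n → ℕ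
  Pot s (u i) = outerPot (cdist (s + toℕ i))
  Pot s (v i) = innerPot (cdist (s + toℕ i))

  Pot-lipschitz : ∀ s → Lipschitz (Pot s)
  Pot-lipschitz s (outer⁺ i) rewrite cdist-edge s i 1 = outerPot-step (proj₁ (cdist-suc (s + toℕ i)))
  Pot-lipschitz s (outer⁻ i) rewrite cdist-edge s i 1 = outerPot-step (proj₂ (cdist-suc (s + toℕ i)))
  Pot-lipschitz s (spoke⁺ i) = innerPot≤1+outerPot _
  Pot-lipschitz s (spoke⁻ i) = outerPot≤1+innerPot _
  Pot-lipschitz s (inner⁺ i) rewrite cdist-edge s i 2 = innerPot-step (proj₁ (cdist-+2 (s + toℕ i)))
  Pot-lipschitz s (inner⁻ i) rewrite cdist-edge s i 2 = innerPot-step (proj₂ (cdist-+2 (s + toℕ i)))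

  innerEdge : ∀ x → Adj n (V n x) (V n (2 + x))
  innerEdge x = subst (Adj n (V n x)) (cong v (mod-cong index)) (inner⁺ (x mod n))
    where
    index : (toℕ (x mod n) + 2) % n ≡ (2 + x) % n
    index = begin
      (toℕ (x mod n) + 2) % n ≡⟨ cong (_% n) (+-comm (toℕ (x mod n)) 2) ⟩
      (2 + toℕ (x mod n)) % n ≡⟨ cong (λ y → (2 + y) % n) (toℕ-fromℕ< _) ⟩
      (2 + x % n) % n         ≡⟨ [m+n%n]%n≡[m+n]%n 2 x ⟩
      (2 + x) % n             ∎
      where open ≡-Reasoning

  innerRoute : ∀ f x y → f * 2 + x ≡ y → Walk n (V n x) (U n y)
  innerRoute zero    x .x refl = spoke⁻ (x mod n) ∷ []
  innerRoute (suc f) x y eq    = innerEdge x ∷ innerRoute f (2 + x) y (trans (x∙yz≈y∙xz (f * 2) 2 x) eq)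

  len-innerRoute : ∀ f x y (eq : f * 2 + x ≡ y) → len (innerRoute f x y eq) ≡ suc f
  len-innerRoute zero    x .x refl = refl
  len-innerRoute (suc f) x y eq    = cong suc (len-innerRoute f (2 + x) y _)

module Main (k m : ℕ) (3≤m : 3 ≤ m) (r≤k : m * 2 ≤ k) where

  N r L : ℕ
  N = suc (2 * k)
  r = m * 2
  L = 2 + m

  open GeneralizedPetersen N

  r≡m+m : r ≡ m + m
  r≡m+m = trans (*-comm m 2) (cong (m +_) (+-identityʳ m))

  r+r<N : r + r < N
  r+r<N = s≤s (subst (r + r ≤_) (cong (k +_) (sym (+-identityʳ k))) (+-mono-≤ r≤k r≤k))

  s : ℕ
  s = N ∸ r

  r+s≡N : r + s ≡ N
  r+s≡N = m+[n∸m]≡n (≤-trans (m≤m+n r r) (<⇒≤ r+r<N))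

  P₀ Pᵣ : Vertex N → ℕ
  P₀ = Pot 0
  Pᵣ = Pot s

  data Position (t : ℕ) : Set where
    onArc  : ∀ {e} → t + e ≡ r → cdist t ≡ t → cdist (s + t) ≡ e → Position t
    offArc : 1 ≤ cdist t → 1 ≤ cdist (s + t) → suc r ≤ cdist t + cdist (s + t) → Position t

  offArc-at : ∀ {t e f} → r + suc e ≡ t → t + suc f ≡ N → Position t
  offArc-at {t} {e} {f} r+e≡t t+f≡N = offArc′ c≡ d≡ (⊓-arcs (s≤s z≤n) (s≤s z≤n) 1+r≤e+f)
    where
    offArc′ : ∀ {c d} → cdist t ≡ c → cdist (s + t) ≡ d → 1 ≤ c × 1 ≤ d × suc r ≤ c + d → Position t
    offArc′ refl refl (1≤c , 1≤d , 1+r≤c+d) = offArc 1≤c 1≤d 1+r≤c+d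
    r+[e+f]≡N : r + (suc e + suc f) ≡ N
    r+[e+f]≡N = trans (sym (+-assoc r (suc e) (suc f))) (trans (cong (_+ suc f) r+e≡t) t+f≡N)
    1+r≤e+f : suc r ≤ suc e + suc f
    1+r≤e+f = +-cancelˡ-< r r _ (subst (r + r <_) (sym r+[e+f]≡N) r+r<N)
    c≡ : cdist t ≡ (r + suc e) ⊓ suc f
    c≡ = trans (cdist-split t+f≡N (s≤s z≤n)) (cong (_⊓ suc f) (sym r+e≡t))
    d≡ : cdist (s + t) ≡ suc e ⊓ (r + suc f)
    d≡ = begin
      cdist (s + t)             ≡⟨ cong (λ x → cdist (s + x)) r+e≡t ⟨
      cdist (s + (r + suc e))   ≡⟨ cong cdist (x∙yz≈z∙yx s r (suc e)) ⟩
      cdist (suc e + (r + s))   ≡⟨ cong (λ x → cdist (suc e + x)) r+s≡N ⟩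
      cdist (suc e + N)         ≡⟨ cdist-+n (suc e) ⟩
      cdist (suc e)             ≡⟨ cdist-split (trans (x∙yz≈yx∙z (suc e) r (suc f)) (trans (cong (_+ suc f) r+e≡t) t+f≡N)) (≤-trans (s≤s z≤n) (m≤n+m (suc f) r)) ⟩
      suc e ⊓ (r + suc f)       ∎
      where open ≡-Reasoning

  position : ∀ t → t < N → Position t
  position t t<N with ≤-<-connex t r
  ... | inj₁ t≤r with m≤n⇒∃[o]m+o≡n t≤r
  ...   | e , t+e≡r = onArc t+e≡r (cdist-small (≤-<-trans (+-mono-≤ t≤r t≤r) r+r<N))
                        (cdist-complement s+t+e≡N (≤-<-trans (+-mono-≤ e≤r e≤r) r+r<N))
    where
    e≤r : e ≤ r
    e≤r = subst (e ≤_) t+e≡r (m≤n+m e t)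
    s+t+e≡N : s + t + e ≡ N
    s+t+e≡N = trans (+-assoc s t e) (trans (cong (s +_) t+e≡r) (trans (+-comm s r) r+s≡N))
  position t t<N | inj₂ r<t with m≤n⇒∃[o]m+o≡n r<t | m≤n⇒∃[o]m+o≡n t<N
  ... | e , 1+r+e≡t | f , 1+t+f≡N = offArc-at (trans (+-suc r e) 1+r+e≡t) (trans (+-suc t f) 1+t+f≡N)

  strictly-above : ∀ {P : Set} {x} → suc L ≤ x → L ≤ x × (x ≤ L → P)
  strictly-above L<x = <⇒≤ L<x , λ x≤L → ⊥-elim (<⇒≱ L<x x≤L)

  outerPot-r : outerPot r ≡ L
  outerPot-r = trans (cong outerPot r≡m+m) (outerPot-double (≤-trans (n≤1+n 2) 3≤m))

  outerPot-cdist-r : outerPot (cdist r) ≡ L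
  outerPot-cdist-r = trans (cong outerPot (cdist-small r+r<N)) outerPot-r

  outer-onArc : ∀ t e → t + e ≡ r →
                L ≤ outerPot t + outerPot e × (outerPot t + outerPot e ≤ L → t ≡ 0 ⊎ t ≡ r)
  outer-onArc zero    e       e≡r   = ≤-reflexive (sym (trans (cong outerPot e≡r) outerPot-r)) , λ _ → inj₁ refl
  outer-onArc (suc t) zero    t+0≡r = ≤-reflexive (sym (trans (+-identityʳ _) (trans (cong outerPot t≡r) outerPot-r)))
                                    , λ _ → inj₂ t≡r
    where
    t≡r : suc t ≡ r
    t≡r = trans (sym (+-identityʳ _)) t+0≡r
  outer-onArc (suc t) (suc e) t+e≡r =
    strictly-above (outerPot-sum 3≤m (s≤s z≤n) (s≤s z≤n) (≤-reflexive (trans (sym r≡m+m) (sym t+e≡r))))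

  outer-total : ∀ t → t < N →
    L ≤ outerPot (cdist t) + outerPot (cdist (s + t)) ×
    (outerPot (cdist t) + outerPot (cdist (s + t)) ≤ L → t ≡ 0 ⊎ t ≡ r)
  outer-total t t<N with position t t<N
  ... | onArc {e} t+e≡r c₀ cᵣ rewrite c₀ | cᵣ = outer-onArc t e t+e≡r
  ... | offArc 1≤c 1≤d 1+r≤c+d =
    strictly-above (outerPot-sum 3≤m 1≤c 1≤d (subst (_≤ cdist t + cdist (s + t)) r≡m+m (<⇒≤ 1+r≤c+d)))

  inner-total : ∀ t → t < N →
    L ≤ innerPot (cdist t) + innerPot (cdist (s + t)) ×
    (innerPot (cdist t) + innerPot (cdist (s + t)) ≤ L → Σ ℕ λ j → j ≤ m × t ≡ j + j)
  inner-total t t<N with position t t<N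
  ... | onArc {e} t+e≡r c₀ cᵣ rewrite c₀ | cᵣ =
    innerPot-sum-≥ (≤-reflexive (sym t+e≡m+m)) , λ tight →
      let t≡C+C = innerPot-sum-tight t+e≡m+m tight in
      ⌈ t /2⌉ , half≤m t≡C+C , t≡C+C
    where
    t+e≡m+m : t + e ≡ m + m
    t+e≡m+m = trans t+e≡r r≡m+m
    half≤m : t ≡ ⌈ t /2⌉ + ⌈ t /2⌉ → ⌈ t /2⌉ ≤ m
    half≤m t≡C+C = subst (⌈ t /2⌉ ≤_) (sym (n≡⌈n+n/2⌉ m))
      (m+m≤n⇒m≤⌈n/2⌉ (subst (_≤ m + m) t≡C+C (subst (t ≤_) t+e≡m+m (m≤m+n t e))))
  ... | offArc _ _ 1+r≤c+d = strictly-above (innerPot-sum-> (subst (_< cdist t + cdist (s + t)) r≡m+m 1+r≤c+d))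

  p : ℕ → Vertex N
  p zero = U N 0
  p (suc j) with j ≤? m
  ... | yes _ = V N (2 * j)
  ... | no  _ = U N r

  p-inner : ∀ {j} → j ≤ m → p (suc j) ≡ V N (2 * j)
  p-inner {j} j≤m with j ≤? m
  ... | yes _   = refl
  ... | no  j≰m = ⊥-elim (j≰m j≤m)

  p-end : p L ≡ U N r
  p-end with suc m ≤? m
  ... | yes 1+m≤m = ⊥-elim (1+n≰n 1+m≤m)
  ... | no  _     = refl

  P₀+Pᵣ≥L : ∀ x → L ≤ P₀ x + Pᵣ x
  P₀+Pᵣ≥L (u i) = proj₁ (outer-total (toℕ i) (toℕ<n i))
  P₀+Pᵣ≥L (v i) = proj₁ (inner-total (toℕ i) (toℕ<n i))

  P₀+Pᵣ≤L⇒on-p : ∀ x → P₀ x + Pᵣ x ≤ L → x ≡ p (P₀ x)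
  P₀+Pᵣ≤L⇒on-p (u i) tight with proj₂ (outer-total (toℕ i) (toℕ<n i)) tight
  ... | inj₁ i≡0 = trans (cong u (toℕ≡⇒≡mod i≡0)) (cong (λ t → p (outerPot (cdist t))) (sym i≡0))
  ... | inj₂ i≡r = begin
    u i                          ≡⟨ cong u (toℕ≡⇒≡mod i≡r) ⟩
    U N r                        ≡⟨ p-end ⟨
    p L                          ≡⟨ cong p outerPot-cdist-r ⟨
    p (outerPot (cdist r))       ≡⟨ cong (λ t → p (outerPot (cdist t))) i≡r ⟨
    p (outerPot (cdist (toℕ i))) ∎
    where open ≡-Reasoning
  P₀+Pᵣ≤L⇒on-p (v i) tight with proj₂ (inner-total (toℕ i) (toℕ<n i)) tight
  ... | j , j≤m , i≡j+j = begin
    v i                          ≡⟨ cong v (toℕ≡⇒≡mod (trans i≡j+j (cong (j +_) (sym (+-identityʳ j))))) ⟩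
    V N (2 * j)                  ≡⟨ p-inner j≤m ⟨
    p (suc j)                    ≡⟨ cong (λ c → p (suc c)) (n≡⌈n+n/2⌉ j) ⟩
    p (innerPot (j + j))         ≡⟨ cong (λ c → p (innerPot c)) (cdist-small j+j+[j+j]<N) ⟨
    p (innerPot (cdist (j + j))) ≡⟨ cong (λ t → p (innerPot (cdist t))) i≡j+j ⟨
    p (innerPot (cdist (toℕ i))) ∎
    where
    open ≡-Reasoning
    j+j+[j+j]<N : j + j + (j + j) < N
    j+j+[j+j]<N = ≤-<-trans (+-mono-≤ j+j≤r j+j≤r) r+r<N
      where
      j+j≤r : j + j ≤ r
      j+j≤r = subst (j + j ≤_) (sym r≡m+m) (+-mono-≤ j≤m j≤m)

  Pᵣ-end : Pᵣ (U N r) ≡ 0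
  Pᵣ-end = cong outerPot (trans (cdist-+-mod s r) (trans (cong cdist (trans (+-comm s r) r+s≡N)) cdist-n))

  P₀-end : P₀ (U N r) ≡ L
  P₀-end = trans (cong outerPot (cdist-+-mod 0 r)) outerPot-cdist-r

  L≤len : ∀ (w : Walk N (U N 0) (U N r)) → L ≤ len w
  L≤len w = subst (_≤ len w) P₀-end (lipschitz-walk (Pot-lipschitz 0) w)

  route : Walk N (U N 0) (U N r)
  route = spoke⁺ (0 mod N) ∷ innerRoute m 0 r (+-identityʳ r)

  len-route : len route ≡ L
  len-route = cong suc (len-innerRoute m 0 r _)

  route-geodesic : IsGeodesic route
  route-geodesic w = subst (_≤ len w) (sym len-route) (L≤len w)

  V₂ : ℕ → Vertex N
  V₂ i = V N (2 * i)

  trace-p-inner : ∀ {j} → j ≤ m → trace p 1 j ≡ map V₂ (upTo (suc j))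
  trace-p-inner {zero}  _      = cong [_] (p-inner z≤n)
  trace-p-inner {suc j} 1+j≤m = begin
    trace p 1 (suc j)                   ≡⟨ trace-∷ʳ p 1 j ⟩
    trace p 1 j ∷ʳ p (suc (suc j))      ≡⟨ cong₂ _∷ʳ_ (trace-p-inner (<⇒≤ 1+j≤m)) (p-inner 1+j≤m) ⟩
    map V₂ (upTo (suc j)) ∷ʳ V₂ (suc j) ≡⟨ map-++ V₂ (upTo (suc j)) [ suc j ] ⟨
    map V₂ (upTo (suc j) ∷ʳ suc j)      ≡⟨ cong (map V₂) (upTo-∷ʳ (suc j)) ⟩
    map V₂ (upTo (suc (suc j)))         ∎
    where open ≡-Reasoning

  trace-p : trace p 0 L ≡ spokeInnerPath N r
  trace-p = cong (U N 0 ∷_) (begin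
    trace p 1 (suc m)                      ≡⟨ trace-∷ʳ p 1 m ⟩
    trace p 1 m ∷ʳ p L                     ≡⟨ cong₂ _∷ʳ_ (trace-p-inner ≤-refl) p-end ⟩
    map V₂ (upTo (suc m)) ∷ʳ U N r         ≡⟨ cong (λ l → map V₂ (upTo l) ∷ʳ U N r) r/2+1≡1+m ⟨
    map V₂ (upTo (r / 2 + 1)) ++ [ U N r ] ∎)
    where
    open ≡-Reasoning
    r/2+1≡1+m : r / 2 + 1 ≡ suc m
    r/2+1≡1+m = trans (cong (_+ 1) (m*n/n≡m m 2)) (+-comm m 1)

  open TightWalks (Pot-lipschitz 0) (Pot-lipschitz s) P₀+Pᵣ≥L {p} P₀+Pᵣ≤L⇒on-p {U N r} Pᵣ-end

  geodesic-vertices : ∀ (g : Walk N (U N 0) (U N r)) → IsGeodesic g → vertices g ≡ spokeInnerPath N r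
  geodesic-vertices g g-geodesic =
    trans (subst (λ l → vertices g ≡ trace p 0 l) len≡L (tight-walk g len≡L)) trace-p
    where
    len≡L : len g ≡ L
    len≡L = ≤-antisym (≤-trans (g-geodesic route) (≤-reflexive len-route)) (L≤len g)

mainTheorem12 : (k r : ℕ) → 2 ∣ r → 5 < r → r ≤ k →
    Σ (Walk (suc (2 * k)) (U (suc (2 * k)) 0) (U (suc (2 * k)) r)) (λ g →
      IsGeodesic g
      × vertices g ≡ spokeInnerPath (suc (2 * k)) r
      × ((g' : Walk (suc (2 * k)) (U (suc (2 * k)) 0) (U (suc (2 * k)) r)) →
           IsGeodesic g' → vertices g' ≡ vertices g))
mainTheorem12 k .(m * 2) (divides m refl) 5<r r≤k =
  route , route-geodesic , route-vertices ,
  λ g g-geodesic → trans (geodesic-vertices g g-geodesic) (sym route-vertices)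
  where
  open Main k m (*-cancelʳ-≤ 3 m 2 5<r) r≤k
  route-vertices : vertices route ≡ spokeInnerPath (suc (2 * k)) (m * 2)
  route-vertices = geodesic-vertices route route-geodesic
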